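{- Let $n\geqslant 2$ and $m\geqslant 1$ be integers, let $k=2m+1$, and let $D_n^k$ be the Dutch windmill graph, i.e. the graph obtained from $n$ pairwise disjoint copies of the cycle $C_k$ by identifying one vertex from each copy into a single common vertex. Then $$D(D_n^k)=\left\lceil \left(\frac{1+\sqrt{8n+1}}{2}\right)^{1/m}\right\rceil.$$
   Context: For a graph $G$, a vertex labeling $\phi:V(G)\to\{1,\dots,r\}$ is $r$-distinguishing if the only automorphism $\sigma$ of $G$ with $\phi(x)=\phi(\sigma(x))$ for all $x\in V(G)$ is the identity. The distinguishing number $D(G)$ is the least $r$ such that $G$ has an $r$-distinguishing vertex labeling. -}

module Defs where

open import Level using (Level; _⊔_; suc)
open import Data.Nat using (ℕ; zero; _+_; _*_; _∸_; _^_; _≤_; _<_)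
import Data.Nat as N
open import Data.Fin using (Fin; toℕ)
open import Data.Product using (Σ; _×_; ∃-syntax)
open import Data.Sum using (_⊎_)
open import Relation.Nullary using (¬_)
open import Relation.Binary.PropositionalEquality using (_≡_)

record Graph : Set₁ where
  field
    V   : Set
    Adj : V → V → Set

open Graph public

record Automorphism (G : Graph) : Set where
  field
    to        : V G → V G
    from      : V G → V G
    to-from   : ∀ x → to (from x) ≡ x
    from-to   : ∀ x → from (to x) ≡ x
    preserves : ∀ x y → Adj G x y → Adj G (to x) (to y)
    reflects  : ∀ x y → Adj G (to x) (to y) → Adj G x y

open Automorphism public

IsDistinguishing : (G : Graph) (r : ℕ) → (V G → Fin r) → Set
IsDistinguishing G r φ =
  (σ : Automorphism G) → (∀ x → φ x ≡ φ (to σ x)) → ∀ x → to σ x ≡ x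

HasDistinguishingLabeling : Graph → ℕ → Set
HasDistinguishingLabeling G r = Σ (V G → Fin r) (IsDistinguishing G r)

DistinguishingNumberIs : Graph → ℕ → Set
DistinguishingNumberIs G r =
  HasDistinguishingLabeling G r × (∀ s → s < r → ¬ HasDistinguishingLabeling G s)

-- Dutch windmill graph D_n^k with k = 2m+1: a hub vertex and n blades;
-- blade i consists of the path vertices (i,0),…,(i,2m-1), and the hub
-- together with blade i forms a cycle of length 2m+1.

data WVertex (n m : ℕ) : Set where
  hub   : WVertex n m
  blade : Fin n → Fin (2 * m) → WVertex n m

-- directed version of the edges (each undirected edge listed once)
data WArc (n m : ℕ) : WVertex n m → WVertex n m → Set where
  hub-first : ∀ i j → toℕ j ≡ 0 → WArc n m hub (blade i j)
  hub-last  : ∀ i j → N.suc (toℕ j) ≡ 2 * m → WArc n m hub (blade i j)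
  path      : ∀ i j j' → N.suc (toℕ j) ≡ toℕ j' → WArc n m (blade i j) (blade i j')

WAdj : (n m : ℕ) → WVertex n m → WVertex n m → Set
WAdj n m x y = WArc n m x y ⊎ WArc n m y x

DutchWindmill : (n m : ℕ) → Graph
DutchWindmill n m = record { V = WVertex n m ; Adj = WAdj n m }

-- r = ⌈((1 + √(8n+1))/2)^(1/m)⌉.  For natural r: r ≥ x^(1/m) ⇔ r^m ≥ x
-- ⇔ 2 r^m - 1 ≥ √(8n+1) ⇔ (2 r^m - 1 ≥ 0 and (2 r^m - 1)^2 ≥ 8n+1).
-- (For r = 0, 2·0^m ∸ 1 = 0 and 0 ≥ 8n+1 fails, matching 0 < x^(1/m).)
SatisfiesBound : ℕ → ℕ → ℕ → Set
SatisfiesBound n m r = 8 * n + 1 ≤ (2 * r ^ m ∸ 1) ^ 2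

IsCeilRoot : ℕ → ℕ → ℕ → Set
IsCeilRoot n m r = SatisfiesBound n m r × (∀ s → s < r → ¬ SatisfiesBound n m s)

{-# OPTIONS --safe #-}
module Submission where

-- Every automorphism of the windmill fixes the hub (the only vertex of degree
-- more than two) and maps each blade onto a blade, either straight or reversed;
-- conversely every such map is an automorphism.  Code the labels of a blade,
-- a word of length 2m over r colours, by its first half and its reversed second
-- half, two elements of Fin (r ^ m): reversing the blade swaps the two codes.
-- So a labeling is distinguishing exactly when the n code pairs are unordered
-- pairs of distinct codes, pairwise different, which is possible exactly when
-- n ≤ C(r ^ m, 2); and n ≤ C(x, 2) is the bound 8n + 1 ≤ (2x - 1)².

open import Defs

open import Data.Bool.Base using (Bool; true; false; _xor_; _∧_; _∨_)
open import Data.Fin.Base as Fin using (Fin; toℕ; fromℕ<; opposite; _↑ˡ_; funToFin; finToFun)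
open import Data.Fin.Patterns using (0F; 1F)
open import Data.Fin.Permutation using (Permutation′; _⟨$⟩ʳ_; _⟨$⟩ˡ_; inverseʳ; inverseˡ; transpose)
open import Data.Fin.Properties as Finₚ
  using ( _≟_; toℕ<n; toℕ-injective; toℕ-fromℕ<; fromℕ<-injective; injective⇒≤; opposite-prop
        ; opposite-involutive; toℕ-↑ˡ; ↑ˡ-injective; funToFin-finToFin; finToFun-funToFin)
open import Data.Nat.Base
open import Data.Nat.Properties hiding (_≟_)
open import Data.Nat.Solver using (module +-*-Solver)
open import Data.Product.Base using (Σ; _×_; _,_; proj₁; proj₂; swap)
open import Data.Sum.Base as Sum using (_⊎_; inj₁; inj₂)
open import Function.Base using (id; _∘_)
open import Function.Bundles using (_⇔_; mk⇔; Equivalence)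
open import Function.Construct.Composition using (_⇔-∘_)
open import Function.Construct.Symmetry using (⇔-sym)
open import Relation.Binary.Definitions using (tri<; tri≈; tri>)
open import Relation.Binary.PropositionalEquality
open import Relation.Nullary using (Dec; yes; no; does; contradiction)
open import Relation.Nullary.Decidable using (dec-true; dec-false)

-- tri x = x (x - 1) / 2 counts the pairs b < a < x.
tri : ℕ → ℕ
tri zero    = zero
tri (suc a) = tri a + a

tri-mono-≤ : ∀ {a b} → a ≤ b → tri a ≤ tri b
tri-mono-≤ z≤n       = z≤n
tri-mono-≤ (s≤s a≤b) = +-mono-≤ (tri-mono-≤ a≤b) a≤b

tri+<tri : ∀ {a b c} → b < a → a < c → tri a + b < tri c
tri+<tri {a} b<a a<c = <-≤-trans (+-monoʳ-< (tri a) b<a) (tri-mono-≤ a<c)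

tri+-injective : ∀ {a b a′ b′} → b < a → b′ < a′ →
                 tri a + b ≡ tri a′ + b′ → a ≡ a′ × b ≡ b′
tri+-injective {a} {b} {a′} {b′} b<a b′<a′ eq with <-cmp a a′
... | tri< a<a′ _ _ = contradiction eq (<⇒≢ (<-≤-trans (tri+<tri b<a a<a′) (m≤m+n (tri a′) b′)))
... | tri> _ _ a′<a = contradiction (sym eq) (<⇒≢ (<-≤-trans (tri+<tri b′<a′ a′<a) (m≤m+n (tri a) b)))
... | tri≈ _ refl _ = refl , +-cancelˡ-≡ (tri a) b b′ eq

tri+<tri⇒< : ∀ {a b c} → tri a + b < tri c → a < c
tri+<tri⇒< {a} {b} lt = ≰⇒> λ c≤a → <⇒≱ lt (≤-trans (tri-mono-≤ c≤a) (m≤m+n (tri a) b))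

record TriDecomposition (c : ℕ) : Set where
  constructor decomposition
  field
    major minor : ℕ
    minor<major : minor < major
    tri+≡       : tri major + minor ≡ c

tri+-surjective : ∀ c → TriDecomposition c
tri+-surjective zero = decomposition 1 0 z<s refl
tri+-surjective (suc c) with tri+-surjective c
... | decomposition a b b<a eq with suc b <? a
...   | yes 1+b<a = decomposition a (suc b) 1+b<a (trans (+-suc (tri a) b) (cong suc eq))
...   | no  1+b≮a = decomposition (suc a) 0 z<s (begin
        tri a + a + 0   ≡⟨ +-identityʳ _ ⟩
        tri a + a       ≡⟨ cong (tri a +_) (≤-antisym (≮⇒≥ 1+b≮a) b<a) ⟩
        tri a + suc b   ≡⟨ +-suc (tri a) b ⟩
        suc (tri a + b) ≡⟨ cong suc eq ⟩
        suc c           ∎)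
  where open ≡-Reasoning

[1+2y]²≡8tri[1+y]+1 : ∀ y → (1 + 2 * y) ^ 2 ≡ 8 * tri (suc y) + 1
[1+2y]²≡8tri[1+y]+1 zero    = refl
[1+2y]²≡8tri[1+y]+1 (suc y) = begin
  (1 + 2 * suc y) ^ 2             ≡⟨ expand y ⟩
  (1 + 2 * y) ^ 2 + 8 * suc y     ≡⟨ cong (_+ 8 * suc y) ([1+2y]²≡8tri[1+y]+1 y) ⟩
  8 * tri (suc y) + 1 + 8 * suc y ≡⟨ collect (tri (suc y)) (suc y) ⟩
  8 * (tri (suc y) + suc y) + 1   ∎
  where
  open ≡-Reasoning
  open +-*-Solver
  expand : ∀ k → (1 + 2 * suc k) ^ 2 ≡ (1 + 2 * k) ^ 2 + 8 * suc k
  expand = solve 1 (λ k → (con 1 :+ con 2 :* (con 1 :+ k)) :^ 2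
                        := (con 1 :+ con 2 :* k) :^ 2 :+ con 8 :* (con 1 :+ k)) refl
  collect : ∀ t k → 8 * t + 1 + 8 * k ≡ 8 * (t + k) + 1
  collect = solve 2 (λ t k → con 8 :* t :+ con 1 :+ con 8 :* k := con 8 :* (t :+ k) :+ con 1) refl

bound⇔≤tri : ∀ {n x} → 1 ≤ n → 8 * n + 1 ≤ (2 * x ∸ 1) ^ 2 ⇔ n ≤ tri x
bound⇔≤tri {n} {zero}  1≤n = mk⇔
  (λ le → contradiction (≤-trans (m≤n+m 1 (8 * n)) le) λ ())
  (λ n≤0 → contradiction (≤-trans 1≤n n≤0) λ ())
-- 2 * suc y ∸ 1 computes to y + suc (y + 0).
bound⇔≤tri {n} {suc y} _ rewrite +-suc y (y + 0) | [1+2y]²≡8tri[1+y]+1 y = mk⇔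
  (λ le → *-cancelˡ-≤ 8 (+-cancelʳ-≤ 1 _ _ le))
  (λ le → +-monoˡ-≤ 1 (*-monoʳ-≤ 8 le))

swapIf : ∀ {A : Set} → Bool → A × A → A × A
swapIf false = id
swapIf true  = swap

swapIf-involutive : ∀ {A : Set} b (x : A × A) → swapIf b (swapIf b x) ≡ x
swapIf-involutive false x = refl
swapIf-involutive true  x = refl

swapIf-∘ : ∀ {A : Set} b c (x : A × A) → swapIf b (swapIf c x) ≡ swapIf (b xor c) x
swapIf-∘ false c     x = refl
swapIf-∘ true  false x = refl
swapIf-∘ true  true  x = refl

SwapSeparated : ∀ {n} {A : Set} → (Fin n → A × A) → Set
SwapSeparated p = ∀ {i i′ b} → p i ≡ swapIf b (p i′) → i ≡ i′ × b ≡ false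

≤tri⇒swapSeparated : ∀ {n N} → n ≤ tri N → Σ (Fin n → Fin N × Fin N) SwapSeparated
≤tri⇒swapSeparated {n} {N} n≤tri = pair , separated
  where
  open TriDecomposition
  code : (i : Fin n) → TriDecomposition (toℕ i)
  code i = tri+-surjective (toℕ i)
  A B : Fin n → ℕ
  A i = major (code i)
  B i = minor (code i)
  A<N : ∀ i → A i < N
  A<N i = tri+<tri⇒< (subst (_< tri N) (sym (tri+≡ (code i))) (<-≤-trans (toℕ<n i) n≤tri))
  B<N : ∀ i → B i < N
  B<N i = <-trans (minor<major (code i)) (A<N i)
  pair : Fin n → Fin N × Fin N
  pair i = fromℕ< (A<N i) , fromℕ< (B<N i)
  separated : SwapSeparated pair
  separated {i} {i′} {false} eq = toℕ-injective (begin
    toℕ i             ≡⟨ tri+≡ (code i) ⟨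
    tri (A i) + B i   ≡⟨ cong₂ (λ a b → tri a + b) A≡ B≡ ⟩
    tri (A i′) + B i′ ≡⟨ tri+≡ (code i′) ⟩
    toℕ i′            ∎) , refl
    where
    open ≡-Reasoning
    A≡ : A i ≡ A i′
    A≡ = fromℕ<-injective _ _ (A<N i) (A<N i′) (cong proj₁ eq)
    B≡ : B i ≡ B i′
    B≡ = fromℕ<-injective _ _ (B<N i) (B<N i′) (cong proj₂ eq)
  separated {i} {i′} {true} eq = contradiction
    (subst (B i′ <_) (sym B≡) (minor<major (code i′)))
    (<-asym (subst (B i <_) A≡ (minor<major (code i))))
    where
    A≡ : A i ≡ B i′
    A≡ = fromℕ<-injective _ _ (A<N i) (B<N i′) (cong proj₁ eq)
    B≡ : B i ≡ A i′
    B≡ = fromℕ<-injective _ _ (B<N i) (A<N i′) (cong proj₂ eq)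

record Sorting {N} (p : Fin N × Fin N) : Set where
  constructor sorting
  field
    larger smaller : Fin N
    smaller<larger : smaller Fin.< larger
    orientation    : Bool
    sorts          : swapIf orientation p ≡ (larger , smaller)

sort : ∀ {N} (p : Fin N × Fin N) → proj₁ p ≢ proj₂ p → Sorting p
sort (x , y) x≢y with Finₚ.<-cmp x y
... | tri< x<y _ _ = sorting y x x<y true refl
... | tri≈ _ x≡y _ = contradiction x≡y x≢y
... | tri> _ _ y<x = sorting x y y<x false refl

swapSeparated⇒≤tri : ∀ {n N} (p : Fin n → Fin N × Fin N) → SwapSeparated p → n ≤ tri N
swapSeparated⇒≤tri {n} {N} p separated = injective⇒≤ key-injective
  where
  distinct : ∀ i → proj₁ (p i) ≢ proj₂ (p i)
  distinct i x≡y with () ← proj₂ (separated {i} {i} {true} (cong₂ _,_ x≡y (sym x≡y)))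
  open Sorting
  sorted : ∀ i → Sorting (p i)
  sorted i = sort (p i) (distinct i)
  key<tri : ∀ i → tri (toℕ (larger (sorted i))) + toℕ (smaller (sorted i)) < tri N
  key<tri i = tri+<tri (smaller<larger (sorted i)) (toℕ<n (larger (sorted i)))
  key : Fin n → Fin (tri N)
  key i = fromℕ< (key<tri i)
  key-injective : ∀ {i i′} → key i ≡ key i′ → i ≡ i′
  key-injective {i} {i′} eq = proj₁ (separated {b = o xor o′} (begin
    p i                               ≡⟨ swapIf-involutive o (p i) ⟨
    swapIf o (swapIf o (p i))         ≡⟨ cong (swapIf o) (sorts s) ⟩
    swapIf o (larger s , smaller s)   ≡⟨ cong (swapIf o) (cong₂ _,_ larger≡ smaller≡) ⟩
    swapIf o (larger s′ , smaller s′) ≡⟨ cong (swapIf o) (sorts s′) ⟨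
    swapIf o (swapIf o′ (p i′))       ≡⟨ swapIf-∘ o o′ (p i′) ⟩
    swapIf (o xor o′) (p i′)          ∎))
    where
    open ≡-Reasoning
    s s′ : Sorting _
    s  = sorted i
    s′ = sorted i′
    o o′ : Bool
    o  = orientation s
    o′ = orientation s′
    same : toℕ (larger s) ≡ toℕ (larger s′) × toℕ (smaller s) ≡ toℕ (smaller s′)
    same = tri+-injective (smaller<larger s) (smaller<larger s′)
             (fromℕ<-injective _ _ (key<tri i) (key<tri i′) eq)
    larger≡ : larger s ≡ larger s′
    larger≡ = toℕ-injective (proj₁ same)
    smaller≡ : smaller s ≡ smaller s′
    smaller≡ = toℕ-injective (proj₂ same)

flipIf : ∀ {k} → Bool → Fin k → Fin k
flipIf false = id
flipIf true  = opposite

flipIf-involutive : ∀ {k} b (j : Fin k) → flipIf b (flipIf b j) ≡ j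
flipIf-involutive false j = refl
flipIf-involutive true  j = opposite-involutive j

suc-toℕ-opposite : ∀ {k} (j : Fin k) → suc (toℕ (opposite j)) ≡ k ∸ toℕ j
suc-toℕ-opposite {k} j = trans (cong suc (opposite-prop j)) (sym (+-∸-assoc 1 (toℕ<n j)))

suc-toℕ-opposite-first : ∀ {k} {j : Fin k} → toℕ j ≡ 0 → suc (toℕ (opposite j)) ≡ k
suc-toℕ-opposite-first {k} {j} j≡0 = trans (suc-toℕ-opposite j) (cong (k ∸_) j≡0)

toℕ-opposite-last : ∀ {k} {j : Fin k} → suc (toℕ j) ≡ k → toℕ (opposite j) ≡ 0
toℕ-opposite-last {k} {j} j≡last = trans (opposite-prop j) (trans (cong (k ∸_) j≡last) (n∸n≡0 k))

opposite-injective : ∀ {k} {j j′ : Fin k} → opposite j ≡ opposite j′ → j ≡ j′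
opposite-injective {j = j} {j′} eq =
  trans (sym (opposite-involutive j)) (trans (cong opposite eq) (opposite-involutive j′))

funToFin-cong : ∀ {k r} {f g : Fin k → Fin r} → f ≗ g → funToFin f ≡ funToFin g
funToFin-cong {zero}  f≗g = refl
funToFin-cong {suc k} f≗g = cong₂ Fin.combine (f≗g Fin.zero) (funToFin-cong (f≗g ∘ Fin.suc))

funToFin-injective : ∀ {k r} {f g : Fin k → Fin r} → funToFin f ≡ funToFin g → f ≗ g
funToFin-injective {f = f} {g} eq k =
  trans (sym (finToFun-funToFin f k)) (trans (cong (λ c → finToFun c k) eq) (finToFun-funToFin g k))

2m∸m≡m : ∀ m → 2 * m ∸ m ≡ m
2m∸m≡m m = trans (m+n∸m≡n m (m + 0)) (+-identityʳ m)

module Halves (m : ℕ) where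

  -- 2 * m reduces to m + (m + 0).
  front : Fin m → Fin (2 * m)
  front k = k ↑ˡ (m + 0)

  back : Fin m → Fin (2 * m)
  back k = opposite (front k)

  toℕ-front : ∀ k → toℕ (front k) ≡ toℕ k
  toℕ-front k = toℕ-↑ˡ k (m + 0)

  front-injective : ∀ {k k′} → front k ≡ front k′ → k ≡ k′
  front-injective = ↑ˡ-injective (m + 0) _ _

  front≢back : (k k′ : Fin m) → front k ≢ back k′
  front≢back k k′ eq = <⇒≱ (subst (_< m) (trans (sym (toℕ-front k)) (cong toℕ eq)) (toℕ<n k)) (begin
    m                            ≡⟨ 2m∸m≡m m ⟨
    2 * m ∸ m                    ≤⟨ ∸-monoʳ-≤ (2 * m) (subst (_< m) (sym (toℕ-front k′)) (toℕ<n k′)) ⟩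
    2 * m ∸ suc (toℕ (front k′)) ≡⟨ opposite-prop (front k′) ⟨
    toℕ (back k′)                ∎)
    where open ≤-Reasoning

  data Half (j : Fin (2 * m)) : Set where
    in-front : ∀ k → front k ≡ j → Half j
    in-back  : ∀ k → back k ≡ j → Half j

  half : (j : Fin (2 * m)) → Half j
  half j with toℕ j <? m
  ... | yes j<m = in-front (fromℕ< j<m) (toℕ-injective (trans (toℕ-front _) (toℕ-fromℕ< j<m)))
  ... | no  j≮m = in-back (fromℕ< opposite<m) (begin
    back (fromℕ< opposite<m) ≡⟨ cong opposite (toℕ-injective (trans (toℕ-front _) (toℕ-fromℕ< opposite<m))) ⟩
    opposite (opposite j)    ≡⟨ opposite-involutive j ⟩
    j                        ∎)
    where
    open ≡-Reasoning
    opposite<m : toℕ (opposite j) < m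
    opposite<m = subst₂ _<_ (sym (opposite-prop j)) (2m∸m≡m m) (∸-monoʳ-< (s≤s (≮⇒≥ j≮m)) (toℕ<n j))

  fromHalves : ∀ {A : Set} → (Fin m → A) → (Fin m → A) → Fin (2 * m) → A
  fromHalves u v j with half j
  ... | in-front k _ = u k
  ... | in-back  k _ = v k

  fromHalves-front : ∀ {A : Set} (u v : Fin m → A) k → fromHalves u v (front k) ≡ u k
  fromHalves-front u v k with half (front k)
  ... | in-front k′ eq = cong u (front-injective eq)
  ... | in-back  k′ eq = contradiction (sym eq) (front≢back k k′)

  fromHalves-back : ∀ {A : Set} (u v : Fin m → A) k → fromHalves u v (back k) ≡ v k
  fromHalves-back u v k with half (back k)
  ... | in-front k′ eq = contradiction eq (front≢back k′ k)
  ... | in-back  k′ eq = cong v (front-injective (opposite-injective eq))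

  halves-determine : ∀ {A : Set} {w w′ : Fin (2 * m) → A} →
                     w ∘ front ≗ w′ ∘ front → w ∘ back ≗ w′ ∘ back → w ≗ w′
  halves-determine same-front same-back j with half j
  ... | in-front k refl = same-front k
  ... | in-back  k refl = same-back k

  halfCodes : ∀ {r} → (Fin (2 * m) → Fin r) → Fin (r ^ m) × Fin (r ^ m)
  halfCodes w = funToFin (w ∘ front) , funToFin (w ∘ back)

  halfCodes-cong : ∀ {r} {w w′ : Fin (2 * m) → Fin r} → w ≗ w′ → halfCodes w ≡ halfCodes w′
  halfCodes-cong w≗w′ = cong₂ _,_ (funToFin-cong (w≗w′ ∘ front)) (funToFin-cong (w≗w′ ∘ back))

  halfCodes-injective : ∀ {r} {w w′ : Fin (2 * m) → Fin r} → halfCodes w ≡ halfCodes w′ → w ≗ w′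
  halfCodes-injective eq =
    halves-determine (funToFin-injective (cong proj₁ eq)) (funToFin-injective (cong proj₂ eq))

  halfCodes-flipIf : ∀ {r} b (w : Fin (2 * m) → Fin r) → halfCodes (w ∘ flipIf b) ≡ swapIf b (halfCodes w)
  halfCodes-flipIf false w = refl
  halfCodes-flipIf true  w = cong (funToFin (w ∘ back) ,_) (funToFin-cong (cong w ∘ opposite-involutive ∘ front))

  wordWithCodes : ∀ {r} → Fin (r ^ m) × Fin (r ^ m) → Fin (2 * m) → Fin r
  wordWithCodes (a , b) = fromHalves (finToFun a) (finToFun b)

  halfCodes-wordWithCodes : ∀ {r} (c : Fin (r ^ m) × Fin (r ^ m)) → halfCodes (wordWithCodes c) ≡ c
  halfCodes-wordWithCodes {r} (a , b) = cong₂ _,_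
    (trans (funToFin-cong (fromHalves-front (finToFun a) (finToFun b))) (funToFin-finToFin {m} {r} a))
    (trans (funToFin-cong (fromHalves-back  (finToFun a) (finToFun b))) (funToFin-finToFin {m} {r} b))

blade-injective : ∀ {n m i i′ j j′} → blade {n} {m} i j ≡ blade i′ j′ → i ≡ i′ × j ≡ j′
blade-injective refl = refl , refl

automorphism-injective : ∀ {G} (σ : Automorphism G) {x y} → to σ x ≡ to σ y → x ≡ y
automorphism-injective σ {x} {y} eq = trans (sym (from-to σ x)) (trans (cong (from σ) eq) (from-to σ y))

module Windmill (n m : ℕ) where

  open Halves m

  Vertex : Set
  Vertex = WVertex n m

  _~_ : Vertex → Vertex → Set
  _~_ = WAdj n m

  bladewise : (Fin n → Fin n) → (Fin n → Bool) → Vertex → Vertex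
  bladewise π f hub         = hub
  bladewise π f (blade i j) = blade (π i) (flipIf (f i) j)

  bladewise-arc : ∀ π f {x y} → WArc n m x y → bladewise π f x ~ bladewise π f y
  bladewise-arc π f (hub-first i j j≡0) with f i
  ... | false = inj₁ (hub-first (π i) j j≡0)
  ... | true  = inj₁ (hub-last (π i) (opposite j) (suc-toℕ-opposite-first j≡0))
  bladewise-arc π f (hub-last i j j≡last) with f i
  ... | false = inj₁ (hub-last (π i) j j≡last)
  ... | true  = inj₁ (hub-first (π i) (opposite j) (toℕ-opposite-last j≡last))
  bladewise-arc π f (path i j j′ step) with f i
  ... | false = inj₁ (path (π i) j j′ step)
  ... | true  = inj₂ (path (π i) (opposite j′) (opposite j)
                       (trans (suc-toℕ-opposite j′) (trans (cong (2 * m ∸_) (sym step)) (sym (opposite-prop j)))))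

  bladewise-preserves : ∀ π f {x y} → x ~ y → bladewise π f x ~ bladewise π f y
  bladewise-preserves π f (inj₁ arc) = bladewise-arc π f arc
  bladewise-preserves π f (inj₂ arc) = Sum.swap (bladewise-arc π f arc)

  bladewiseAutomorphism : Permutation′ n → (Fin n → Bool) → Automorphism (DutchWindmill n m)
  bladewiseAutomorphism π f = record
    { to        = σ
    ; from      = σ⁻¹
    ; to-from   = λ { hub → refl
                    ; (blade i j) → cong₂ blade (inverseʳ π) (flipIf-involutive (f (π ⟨$⟩ˡ i)) j) }
    ; from-to   = from-to′
    ; preserves = λ _ _ → bladewise-preserves _ _
    ; reflects  = λ x y adj → subst₂ _~_ (from-to′ x) (from-to′ y) (bladewise-preserves _ _ adj)
    }
    where
    σ σ⁻¹ : Vertex → Vertex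
    σ   = bladewise (π ⟨$⟩ʳ_) f
    σ⁻¹ = bladewise (π ⟨$⟩ˡ_) (f ∘ (π ⟨$⟩ˡ_))
    from-to′ : ∀ x → σ⁻¹ (σ x) ≡ x
    from-to′ hub         = refl
    from-to′ (blade i j) = cong₂ blade (inverseˡ π)
      (trans (cong (λ k → flipIf (f k) _) (inverseˡ π)) (flipIf-involutive (f i) j))

  -- With i ≡ i′ this reverses blade i alone (when b is true).
  exchange : Fin n → Fin n → Bool → Automorphism (DutchWindmill n m)
  exchange i i′ b = bladewiseAutomorphism (transpose i i′) (λ k → (does (k ≟ i) ∨ does (k ≟ i′)) ∧ b)

  exchange-first : ∀ i i′ b j → to (exchange i i′ b) (blade i j) ≡ blade i′ (flipIf b j)
  exchange-first i i′ b j rewrite dec-true (i ≟ i) refl = refl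

  exchange-second : ∀ i i′ b j → to (exchange i i′ b) (blade i′ j) ≡ blade i (flipIf b j)
  exchange-second i i′ b j with i′ ≟ i
  ... | yes refl = refl
  ... | no  _    rewrite dec-true (i′ ≟ i′) refl = refl

  exchange-other : ∀ i i′ b {k} j → k ≢ i → k ≢ i′ → to (exchange i i′ b) (blade k j) ≡ blade k j
  exchange-other i i′ b {k} j k≢i k≢i′ rewrite dec-false (k ≟ i) k≢i | dec-false (k ≟ i′) k≢i′ = refl

  hubNeighbour : ∀ {y} → hub ~ y →
                 Σ (Fin n) λ i → Σ (Fin (2 * m)) λ j → y ≡ blade i j × (toℕ j ≡ 0 ⊎ suc (toℕ j) ≡ 2 * m)
  hubNeighbour (inj₁ (hub-first i j j≡0))   = i , j , refl , inj₁ j≡0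
  hubNeighbour (inj₁ (hub-last i j j≡last)) = i , j , refl , inj₂ j≡last
  hubNeighbour (inj₂ ())

  data BladeNeighbour (i : Fin n) (j : Fin (2 * m)) : Fin 2 → Vertex → Set where
    hub-before : toℕ j ≡ 0 → BladeNeighbour i j 0F hub
    before     : ∀ {j′} → suc (toℕ j′) ≡ toℕ j → BladeNeighbour i j 0F (blade i j′)
    hub-after  : suc (toℕ j) ≡ 2 * m → BladeNeighbour i j 1F hub
    after      : ∀ {j′} → suc (toℕ j) ≡ toℕ j′ → BladeNeighbour i j 1F (blade i j′)

  bladeNeighbour : ∀ {i j y} → blade i j ~ y → Σ (Fin 2) λ s → BladeNeighbour i j s y
  bladeNeighbour (inj₁ (path i j j′ step))    = 1F , after step
  bladeNeighbour (inj₂ (hub-first i j j≡0))   = 0F , hub-before j≡0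
  bladeNeighbour (inj₂ (hub-last i j j≡last)) = 1F , hub-after j≡last
  bladeNeighbour (inj₂ (path i j′ j step))    = 0F , before step

  sameSide⇒≡ : ∀ {i j s s′ y y′} → BladeNeighbour i j s y → BladeNeighbour i j s′ y′ → s ≡ s′ → y ≡ y′
  sameSide⇒≡ (hub-before _)     (hub-before _)     refl = refl
  sameSide⇒≡ (hub-before j≡0)   (before step)      refl = contradiction (trans step j≡0) λ ()
  sameSide⇒≡ (before step)      (hub-before j≡0)   refl = contradiction (trans step j≡0) λ ()
  sameSide⇒≡ (before step)      (before step′)     refl =
    cong (blade _) (toℕ-injective (suc-injective (trans step (sym step′))))
  sameSide⇒≡ (hub-after _)      (hub-after _)      refl = refl
  sameSide⇒≡ (hub-after j≡last) (after {j′} step)  refl = contradiction (trans (sym step) j≡last) (<⇒≢ (toℕ<n j′))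
  sameSide⇒≡ (after {j′} step)  (hub-after j≡last) refl = contradiction (trans (sym step) j≡last) (<⇒≢ (toℕ<n j′))
  sameSide⇒≡ (after step)       (after step′)      refl = cong (blade _) (toℕ-injective (trans (sym step) step′))

  blade-degree≤2 : ∀ {k i j} (g : Fin k → Vertex) → (∀ {x x′} → g x ≡ g x′ → x ≡ x′) →
                   (∀ x → blade i j ~ g x) → k ≤ 2
  blade-degree≤2 g g-injective adjacent = injective⇒≤ λ {x} {x′} sides≡ →
    g-injective (sameSide⇒≡ (proj₂ (bladeNeighbour (adjacent x)))
                            (proj₂ (bladeNeighbour (adjacent x′))) sides≡)

  module _ (f : Vertex → Vertex) (f-injective : ∀ {x y} → f x ≡ f y → x ≡ y)
           (f-preserves : ∀ {x y} → x ~ y → f x ~ f y) (f-hub : f hub ≡ hub) {i i′ : Fin n} where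

    blade-maps-straight : (∀ {j} → toℕ j ≡ 0 → f (blade i j) ≡ blade i′ j) → ∀ j → f (blade i j) ≡ blade i′ j
    blade-maps-straight start j = up-to (toℕ j) ≤-refl
      where
      up-to : ∀ t {j} → toℕ j ≤ t → f (blade i j) ≡ blade i′ j
      up-to zero    j≤0   = start (n≤0⇒n≡0 j≤0)
      up-to (suc t) {j} j≤1+t with m≤n⇒m<n∨m≡n j≤1+t
      ... | inj₁ j<1+t = up-to t (s≤s⁻¹ j<1+t)
      ... | inj₂ j≡1+t = next (proj₂ (bladeNeighbour adjacent)) refl
        where
        t<2m : t < 2 * m
        t<2m = <-trans (n<1+n t) (subst (_< 2 * m) j≡1+t (toℕ<n j))
        p : Fin (2 * m)
        p = fromℕ< t<2m
        p≡t : toℕ p ≡ t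
        p≡t = toℕ-fromℕ< t<2m
        adjacent : blade i′ p ~ f (blade i j)
        adjacent = subst (_~ f (blade i j)) (up-to t (≤-reflexive p≡t))
                     (f-preserves (inj₁ (path i p j (trans (cong suc p≡t) (sym j≡1+t)))))
        -- Of the neighbours of blade i′ p, the hub and the predecessor are already images of other vertices.
        next : ∀ {s y} → BladeNeighbour i′ p s y → f (blade i j) ≡ y → f (blade i j) ≡ blade i′ j
        next (hub-before _) eq = contradiction (f-injective (trans eq (sym f-hub))) λ ()
        next (hub-after _)  eq = contradiction (f-injective (trans eq (sym f-hub))) λ ()
        next (after step)   eq =
          trans eq (cong (blade i′) (toℕ-injective (trans (sym step) (trans (cong suc p≡t) (sym j≡1+t)))))
        next (before {j′} step) eq =
          contradiction (cong toℕ (proj₂ (blade-injective j≡j′))) (>⇒≢ (subst (toℕ j′ <_) (sym j≡1+t) (s≤s j′≤t)))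
          where
          j′≤t : toℕ j′ ≤ t
          j′≤t = ≤-trans (n≤1+n _) (≤-reflexive (trans step p≡t))
          j≡j′ : blade i j ≡ blade i j′
          j≡j′ = f-injective (trans eq (sym (up-to t j′≤t)))

  DistinctBladeLabels : ∀ {r} → (Vertex → Fin r) → Set
  DistinctBladeLabels φ =
    ∀ {i i′ b} → (∀ j → φ (blade i j) ≡ φ (blade i′ (flipIf b j))) → i ≡ i′ × b ≡ false

  bladeWord : ∀ {r} → (Vertex → Fin r) → Fin n → Fin (2 * m) → Fin r
  bladeWord φ i j = φ (blade i j)

  distinctBladeLabels⇔swapSeparated : ∀ {r} (φ : Vertex → Fin r) →
    DistinctBladeLabels φ ⇔ SwapSeparated (halfCodes ∘ bladeWord φ)
  distinctBladeLabels⇔swapSeparated φ = mk⇔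
    (λ distinct {i} {i′} {b} eq →
       distinct (halfCodes-injective (trans eq (sym (halfCodes-flipIf b (bladeWord φ i′))))))
    (λ separated {i} {i′} {b} match →
       separated (trans (halfCodes-cong match) (halfCodes-flipIf b (bladeWord φ i′))))

  module _ (1≤m : 1 ≤ m) where

    j₀ : Fin (2 * m)
    j₀ = front (fromℕ< 1≤m)

    toℕ-j₀ : toℕ j₀ ≡ 0
    toℕ-j₀ = trans (toℕ-front _) (toℕ-fromℕ< 1≤m)

    toℕ≡0⇒≡j₀ : ∀ {j} → toℕ j ≡ 0 → j ≡ j₀
    toℕ≡0⇒≡j₀ j≡0 = toℕ-injective (trans j≡0 (sym toℕ-j₀))

    opposite-j₀ : opposite j₀ ≢ j₀
    opposite-j₀ eq = front≢back _ _ (sym eq)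

    flipIf-fixes-j₀ : ∀ b → flipIf b j₀ ≡ j₀ → b ≡ false
    flipIf-fixes-j₀ false _  = refl
    flipIf-fixes-j₀ true  eq = contradiction eq opposite-j₀

    distinguishing⇒distinctBladeLabels : ∀ {r} {φ : Vertex → Fin r} →
      IsDistinguishing (DutchWindmill n m) r φ → DistinctBladeLabels φ
    distinguishing⇒distinctBladeLabels {φ = φ} distinguishing {i} {i′} {b} match =
      sym (proj₁ (blade-injective fixed)) , flipIf-fixes-j₀ b (proj₂ (blade-injective fixed))
      where
      σ : Automorphism (DutchWindmill n m)
      σ = exchange i i′ b
      labels : ∀ x → φ x ≡ φ (to σ x)
      labels hub = refl
      labels (blade k j) = blade-labels (k ≟ i) (k ≟ i′)
        where
        blade-labels : Dec (k ≡ i) → Dec (k ≡ i′) → φ (blade k j) ≡ φ (to σ (blade k j))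
        blade-labels (yes refl) _ = trans (match j) (cong φ (sym (exchange-first i i′ b j)))
        blade-labels (no _) (yes refl) =
          trans (sym (trans (match (flipIf b j)) (cong (φ ∘ blade i′) (flipIf-involutive b j))))
                (cong φ (sym (exchange-second i i′ b j)))
        blade-labels (no k≢i) (no k≢i′) = cong φ (sym (exchange-other i i′ b j k≢i k≢i′))
      fixed : blade i′ (flipIf b j₀) ≡ blade i j₀
      fixed = trans (sym (exchange-first i i′ b j₀)) (distinguishing σ labels (blade i j₀))

    module _ (2≤n : 2 ≤ n) where

      i₀ : Fin n
      i₀ = fromℕ< (≤-trans (s≤s z≤n) 2≤n)

      spoke : Fin (suc n) → Vertex
      spoke 0F          = blade i₀ (opposite j₀)
      spoke (Fin.suc i) = blade i j₀

      hub~spoke : ∀ x → hub ~ spoke x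
      hub~spoke 0F          = inj₁ (hub-last i₀ (opposite j₀) (suc-toℕ-opposite-first toℕ-j₀))
      hub~spoke (Fin.suc i) = inj₁ (hub-first i j₀ toℕ-j₀)

      spoke-injective : ∀ {x x′} → spoke x ≡ spoke x′ → x ≡ x′
      spoke-injective {0F}        {0F}        _  = refl
      spoke-injective {0F}        {Fin.suc _} eq = contradiction (proj₂ (blade-injective eq)) opposite-j₀
      spoke-injective {Fin.suc _} {0F}        eq = contradiction (sym (proj₂ (blade-injective eq))) opposite-j₀
      spoke-injective {Fin.suc _} {Fin.suc _} eq = cong Fin.suc (proj₁ (blade-injective eq))

      hub-fixed : (σ : Automorphism (DutchWindmill n m)) → to σ hub ≡ hub
      hub-fixed σ with to σ hub in σhub
      ... | hub       = refl
      ... | blade i j = contradiction 2≤n (<⇒≱ (blade-degree≤2 (to σ ∘ spoke)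
                          (spoke-injective ∘ automorphism-injective σ) adjacent))
        where
        adjacent : ∀ x → blade i j ~ to σ (spoke x)
        adjacent x = subst (_~ to σ (spoke x)) σhub (preserves σ _ _ (hub~spoke x))

      blade-image : (σ : Automorphism (DutchWindmill n m)) (i : Fin n) →
                    Σ (Fin n) λ i′ → Σ Bool λ b → ∀ j → to σ (blade i j) ≡ blade i′ (flipIf b j)
      blade-image σ i with hubNeighbour (subst (_~ to σ (blade i j₀)) (hub-fixed σ)
                                                (preserves σ _ _ (hub~spoke (Fin.suc i))))
      ... | i′ , j′ , eq , inj₁ j′≡0 = i′ , false ,
            blade-maps-straight (to σ) (automorphism-injective σ) (preserves σ _ _) (hub-fixed σ) start
        where
        start : ∀ {j} → toℕ j ≡ 0 → to σ (blade i j) ≡ blade i′ j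
        start j≡0 rewrite toℕ≡0⇒≡j₀ j≡0 = trans eq (cong (blade i′) (toℕ≡0⇒≡j₀ j′≡0))
      ... | i′ , j′ , eq , inj₂ j′≡last = i′ , true , λ j →
            automorphism-injective ρ (trans (reversed j)
              (sym (trans (exchange-first i′ i′ true (opposite j)) (cong (blade i′) (opposite-involutive j)))))
        where
        ρ : Automorphism (DutchWindmill n m)
        ρ = exchange i′ i′ true
        start : ∀ {j} → toℕ j ≡ 0 → to ρ (to σ (blade i j)) ≡ blade i′ j
        start j≡0 rewrite toℕ≡0⇒≡j₀ j≡0 =
          trans (cong (to ρ) eq) (trans (exchange-first i′ i′ true j′)
                                        (cong (blade i′) (toℕ≡0⇒≡j₀ (toℕ-opposite-last j′≡last))))
        reversed : ∀ j → to ρ (to σ (blade i j)) ≡ blade i′ j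
        reversed = blade-maps-straight (to ρ ∘ to σ) (automorphism-injective σ ∘ automorphism-injective ρ)
                     (preserves ρ _ _ ∘ preserves σ _ _) (cong (to ρ) (hub-fixed σ)) start

      distinctBladeLabels⇒distinguishing : ∀ {r} {φ : Vertex → Fin r} →
        DistinctBladeLabels φ → IsDistinguishing (DutchWindmill n m) r φ
      distinctBladeLabels⇒distinguishing distinct σ labels hub = hub-fixed σ
      distinctBladeLabels⇒distinguishing {φ = φ} distinct σ labels (blade i j) with blade-image σ i
      ... | i′ , b , image with distinct {i} {i′} {b} (λ j′ → trans (labels (blade i j′)) (cong φ (image j′)))
      ...   | refl , refl = image j

      -- The hub's label is irrelevant: every automorphism fixes the hub.
      labelingWithCodes : ∀ {r} → (Fin n → Fin (r ^ m) × Fin (r ^ m)) → Vertex → Fin r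
      labelingWithCodes p hub         = wordWithCodes (p i₀) j₀
      labelingWithCodes p (blade i j) = wordWithCodes (p i) j

      labelingWithCodes-distinguishing : ∀ {r} {p : Fin n → Fin (r ^ m) × Fin (r ^ m)} →
        SwapSeparated p → IsDistinguishing (DutchWindmill n m) r (labelingWithCodes p)
      labelingWithCodes-distinguishing {p = p} separated =
        distinctBladeLabels⇒distinguishing (Equivalence.from (distinctBladeLabels⇔swapSeparated (labelingWithCodes p))
          λ {i} {i′} {b} eq → separated (subst₂ (λ x y → x ≡ swapIf b y)
                                          (halfCodes-wordWithCodes (p i)) (halfCodes-wordWithCodes (p i′)) eq))

      hasDistinguishingLabeling⇔≤tri : ∀ {r} →
        HasDistinguishingLabeling (DutchWindmill n m) r ⇔ n ≤ tri (r ^ m)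
      hasDistinguishingLabeling⇔≤tri = mk⇔
        (λ (φ , distinguishing) → swapSeparated⇒≤tri _ (Equivalence.to (distinctBladeLabels⇔swapSeparated φ)
                                     (distinguishing⇒distinctBladeLabels distinguishing)))
        (λ n≤tri → let (p , separated) = ≤tri⇒swapSeparated n≤tri in
                   labelingWithCodes p , labelingWithCodes-distinguishing separated)

      hasDistinguishingLabeling⇔satisfiesBound : ∀ {r} →
        HasDistinguishingLabeling (DutchWindmill n m) r ⇔ SatisfiesBound n m r
      hasDistinguishingLabeling⇔satisfiesBound {r} =
        ⇔-sym (bound⇔≤tri {x = r ^ m} (≤-trans (s≤s z≤n) 2≤n)) ⇔-∘ hasDistinguishingLabeling⇔≤tri

mainTheorem6 : (n m : ℕ) → 2 ≤ n → 1 ≤ m → (r : ℕ) → IsCeilRoot n m r →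
    DistinguishingNumberIs (DutchWindmill n m) r
mainTheorem6 n m 2≤n 1≤m r (satisfied , minimal) =
  Equivalence.from labeling⇔bound satisfied ,
  λ s s<r → minimal s s<r ∘ Equivalence.to labeling⇔bound
  where
  labeling⇔bound : ∀ {s} → HasDistinguishingLabeling (DutchWindmill n m) s ⇔ SatisfiesBound n m s
  labeling⇔bound = Windmill.hasDistinguishingLabeling⇔satisfiesBound n m 1≤m 2≤n
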